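{- Let $(T,\tau)$ be a tree-decomposition of a matroid $M$. Suppose that $T$ has an edge $e=uw$ that displays the sets $U,W\subseteq E(M)$, where $U\subseteq \mathrm{cl}(W)$. Then there exists another tree-decomposition $(T',\tau')$ of $M$ having width at most the width of $(T,\tau)$, such that $|V(T')|<|V(T)|$.
   Context: A tree-decomposition of a matroid $M$ is a pair $(T,\tau)$ with $T$ a tree and $\tau:E(M)\to V(T)$ an arbitrary map. For a vertex $v$ of $T$, let $T_1,\dots,T_c$ be the components of $T-v$ and $B_j=\{e\in E(M):\tau(e)\in V(T_j)\}$. The rank defect of a set $B$ is $\mathrm{rd}(B)=r(M)-r(E(M)-B)$. The node width of $v$ is $r(M)-\sum_{j=1}^{c}\mathrm{rd}(B_j)$ (equal to $r(M)$ if $T$ has one vertex). The width of $(T,\tau)$ is the maximum node width over the vertices of $T$. For an edge $e=uw$ of $T$, with $T_u,T_w$ the components of $T\setminus e$ containing $u,w$ respectively, the edge $e$ displays the sets $U=\{x:\tau(x)\in V(T_u)\}$ and $W=\{x:\tau(x)\in V(T_w)\}$. $\mathrm{cl}$ denotes closure in $M$. -}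

module Defs where

open import Data.Nat using (ℕ; zero; suc; _+_; _∸_; _≤_; _<_; _⊔_)
open import Data.Bool using (Bool; true; false; T; _∧_; _∨_; not; if_then_else_)
open import Data.Fin using (Fin; _≟_; _<?_)
open import Data.Fin.Subset using (Subset; _∪_; _∩_; ∁; ⁅_⁆; ⊤; _⊆_; _∈_; ∣_∣)
open import Data.Vec using (Vec; tabulate; lookup)
open import Data.List using (List; []; _∷_; length; _∷ʳ_; allFin; foldr; map)
open import Data.Bool.ListAction using (any; all)
open import Data.List.Relation.Unary.Unique.Propositional using (Unique)
open import Data.Product using (Σ; _×_; _,_)
open import Data.Unit using () renaming (⊤ to Unit)
open import Relation.Binary.PropositionalEquality using (_≡_)
open import Relation.Nullary using (¬_)
open import Relation.Nullary.Decidable using (⌊_⌋)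

record Matroid : Set where
  field
    n      : ℕ
    r      : Subset n → ℕ
    r-card : ∀ X → r X ≤ ∣ X ∣
    r-mono : ∀ X Y → X ⊆ Y → r X ≤ r Y
    r-sub  : ∀ X Y → r (X ∪ Y) + r (X ∩ Y) ≤ r X + r Y

module _ (M : Matroid) where
  open Matroid M

  rM : ℕ
  rM = r ⊤

  _∈cl_ : Fin n → Subset n → Set
  e ∈cl X = r (X ∪ ⁅ e ⁆) ≡ r X

  rd : Subset n → ℕ
  rd B = rM ∸ r (∁ B)

record Graph (m : ℕ) : Set where
  field
    adj       : Fin m → Fin m → Bool
    adj-sym   : ∀ x y → adj x y ≡ adj y x
    adj-irref : ∀ x → adj x x ≡ false

anyFin : ∀ {m} → (Fin m → Bool) → Bool
anyFin {m} p = any p (allFin m)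

reachWithin : ∀ {m} → (Fin m → Fin m → Bool) → ℕ → Fin m → Subset m
reachWithin A zero    x = ⁅ x ⁆
reachWithin A (suc k) x =
  let S = reachWithin A k x in
  tabulate (λ y → lookup S y ∨ anyFin (λ z → lookup S z ∧ A z y))

-- Connected component containing x (walks of length ≤ m suffice).
reach : ∀ {m} → (Fin m → Fin m → Bool) → Fin m → Subset m
reach {m} A x = reachWithin A m x

module _ {m : ℕ} (G : Graph m) where
  open Graph G

  Chain : List (Fin m) → Set
  Chain []           = Unit
  Chain (x ∷ [])     = Unit
  Chain (x ∷ y ∷ zs) = T (adj x y) × Chain (y ∷ zs)

  IsCycle : Fin m → List (Fin m) → Set
  IsCycle x xs = (2 ≤ length xs) × Unique (x ∷ xs) × Chain ((x ∷ xs) ∷ʳ x)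

  Connected : Set
  Connected = ∀ x y → y ∈ reach adj x

  Acyclic : Set
  Acyclic = ∀ x xs → ¬ IsCycle x xs

  IsTree : Set
  IsTree = Connected × Acyclic

  adjMinusV : Fin m → Fin m → Fin m → Bool
  adjMinusV v x y = not ⌊ x ≟ v ⌋ ∧ not ⌊ y ≟ v ⌋ ∧ adj x y

  adjMinusE : Fin m → Fin m → Fin m → Fin m → Bool
  adjMinusE u w x y =
    adj x y ∧ not ((⌊ x ≟ u ⌋ ∧ ⌊ y ≟ w ⌋) ∨ (⌊ x ≟ w ⌋ ∧ ⌊ y ≟ u ⌋))

record TreeDec (M : Matroid) : Set where
  field
    k      : ℕ                      -- T has |V(T)| = suc k vertices
    T-gr   : Graph (suc k)
    T-tree : IsTree T-gr
    τ      : Fin (Matroid.n M) → Fin (suc k)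

module _ {M : Matroid} (D : TreeDec M) where
  open TreeDec D
  open Graph T-gr

  vcount : ℕ
  vcount = suc k

  preimage : Subset (suc k) → Subset (Matroid.n M)
  preimage C = tabulate (λ e → lookup C (τ e))

  compMinusV : Fin (suc k) → Fin (suc k) → Subset (suc k)
  compMinusV v x = reach (adjMinusV T-gr v) x

  -- x ≠ v is the least-indexed vertex of its component of T - v;
  -- each component of T - v has exactly one such representative
  isRep : Fin (suc k) → Fin (suc k) → Bool
  isRep v x = not ⌊ x ≟ v ⌋ ∧
    all (λ y → not (⌊ y <? x ⌋ ∧ lookup (compMinusV v x) y)) (allFin (suc k))

  sumRd : Fin (suc k) → ℕ
  sumRd v = foldr _+_ 0
    (map (λ x → if isRep v x then rd M (preimage (compMinusV v x)) else 0)
         (allFin (suc k)))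

  nodeWidth : Fin (suc k) → ℕ
  nodeWidth v = rM M ∸ sumRd v

  width : ℕ
  width = foldr _⊔_ 0 (map nodeWidth (allFin (suc k)))

  displayU : Fin (suc k) → Fin (suc k) → Subset (Matroid.n M)
  displayU u w = preimage (reach (adjMinusE T-gr u w) u)

  displayW : Fin (suc k) → Fin (suc k) → Subset (Matroid.n M)
  displayW u w = preimage (reach (adjMinusE T-gr u w) w)

  isEdge : Fin (suc k) → Fin (suc k) → Set
  isEdge u w = T (adj u w)

module Submission where

-- Pick a leaf ℓ of T on u's side of uw (walk away from w until stuck), delete it and move its
-- bag τ⁻¹(ℓ) to its neighbour p. That bag lies in U ⊆ cl(W) and is disjoint from W, so its
-- complement spans M and rd(τ⁻¹(ℓ)) = 0. For every remaining node v, the components of T - v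
-- are those of the smaller tree with ℓ absorbed into the component of p, except that the
-- component {ℓ} disappears when v = p; it contributed rd = 0, so no node width changes.

open import Defs
open import Data.Bool using (Bool; true; false; T; _∧_; _∨_; not; if_then_else_)
open import Data.Bool.ListAction using (all)
open import Data.Bool.Properties using (T-≡; T-∧; T-∨; ∧-comm; ∧-assoc; ∨-comm; ∧-zeroʳ)
open import Data.Empty using (⊥-elim)
open import Data.Fin using (Fin; zero; suc; toℕ; punchIn; punchOut; _≟_; _<?_) renaming (_<_ to _<ᶠ_)
import Data.Fin.Properties as FinP
open import Data.Fin.Subset using (Subset; _∪_; _∩_; ∁; ⁅_⁆; ⊤; _⊆_; _∈_)
open import Data.Fin.Subset.Properties
  using (p⊆p∪q; q⊆p∪q; x∈p∪q⁻; x∈p∩q⁺; x∈⁅x⁆; x∈⁅y⁆⇒x≡y; x∉p⇒x∈∁p; p⊆q⇒∁p⊇∁q)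
  renaming (_∈?_ to _∈ˢ?_)
open import Data.List using (List; []; _∷_; length; _∷ʳ_; allFin; foldr; map; tabulate)
import Data.List as List
import Data.List.Properties as ListP
open import Data.List.Membership.Propositional using () renaming (_∈_ to _∈ˡ_)
open import Data.List.Membership.Propositional.Properties using (∈-map⁺; ∈-allFin; ∈-lookup)
open import Data.List.Relation.Binary.Subset.Propositional using () renaming (_⊆_ to _⊆ˡ_)
open import Data.List.Relation.Unary.All as All using (All)
import Data.List.Relation.Unary.All.Properties as AllP
open import Data.List.Relation.Unary.AllPairs using ([]; _∷_)
import Data.List.Relation.Unary.Any as Any
import Data.List.Relation.Unary.Any.Properties as AnyP
open import Data.List.Relation.Unary.Unique.Propositional using (Unique)
import Data.List.Relation.Unary.Unique.Propositional.Properties as UniqueP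
open import Data.Nat using (ℕ; zero; suc; _+_; _∸_; _≤_; _<_; _⊔_; z≤n; s≤s; _≤′_; ≤′-refl; ≤′-step)
import Data.Nat.Properties as ℕP
open import Algebra.Properties.CommutativeMonoid.Sum ℕP.+-0-commutativeMonoid
  using (sum; sum-remove; ∑-distrib-+; sum-cong-≗; sum-replicate-zero)
open import Data.Product using (Σ; ∃; ∃₂; _×_; _,_; proj₁; proj₂)
open import Data.Sum using (_⊎_; inj₁; inj₂; [_,_]′)
open import Data.Unit using (tt)
open import Data.Vec using (lookup)
import Data.Vec.Properties as VecP
open import Function using (id; _∘_; Equivalence)
open import Relation.Binary.Construct.Closure.ReflexiveTransitive using (Star; ε; _◅_; _◅◅_)
import Relation.Binary.Construct.Closure.ReflexiveTransitive as Star
open import Relation.Binary.Definitions using (tri<; tri≈; tri>)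
open import Relation.Binary.PropositionalEquality
open import Relation.Nullary using (¬_; Dec; yes; no; contradiction)
open import Relation.Nullary.Decidable using (⌊_⌋; T?; ¬?; _×-dec_; toWitnessFalse; fromWitnessFalse)
import Relation.Nullary.Decidable as Dec

T-not⁺ : ∀ {b} → ¬ T b → T (not b)
T-not⁺ {false} _  = tt
T-not⁺ {true}  ¬b = ¬b tt

T-not⁻ : ∀ {b} → T (not b) → ¬ T b
T-not⁻ {true} ()

T-∧⁺ : ∀ {a b} → T a → T b → T (a ∧ b)
T-∧⁺ {true} _ tb = tb

T-∧ˡ : ∀ a {b} → T (a ∧ b) → T a
T-∧ˡ true _ = tt

T-∧ʳ : ∀ a {b} → T (a ∧ b) → T b
T-∧ʳ true t = t

T-∨ˡ : ∀ {a b} → T a → T (a ∨ b)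
T-∨ˡ {true} _ = tt

T-∨⁻ : ∀ a {b} → T (a ∨ b) → T a ⊎ T b
T-∨⁻ true  _ = inj₁ tt
T-∨⁻ false t = inj₂ t

T-ext : ∀ {a b} → (T a → T b) → (T b → T a) → a ≡ b
T-ext {false} {false} _ _ = refl
T-ext {false} {true}  _ f = ⊥-elim (f tt)
T-ext {true}  {false} f _ = ⊥-elim (f tt)
T-ext {true}  {true}  _ _ = refl

if-T : ∀ {b} {n : ℕ} → T b → (if b then n else 0) ≡ n
if-T {true} _ = refl

if-¬T : ∀ {b} {n : ℕ} → ¬ T b → (if b then n else 0) ≡ 0
if-¬T {false} _ = refl
if-¬T {true}  f = ⊥-elim (f tt)

sum-allFin : ∀ {n} (g : Fin n → ℕ) → foldr _+_ 0 (map g (allFin n)) ≡ sum g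
sum-allFin {n} g = trans (cong (foldr _+_ 0) (ListP.map-tabulate id g)) (sum-tabulate g)
  where
  sum-tabulate : ∀ {n} (g : Fin n → ℕ) → foldr _+_ 0 (tabulate g) ≡ sum g
  sum-tabulate {zero}  g = refl
  sum-tabulate {suc n} g = cong (g zero +_) (sum-tabulate (g ∘ suc))

sum-zero : ∀ {n} {g : Fin n → ℕ} → (∀ i → g i ≡ 0) → sum g ≡ 0
sum-zero {n} g0 = trans (sum-cong-≗ g0) (sum-replicate-zero n)

sum-zero-except : ∀ {n} {g : Fin n → ℕ} i → (∀ j → j ≢ i → g j ≡ 0) → sum g ≡ g i
sum-zero-except {suc n} {g} i g0 = begin
  sum g                         ≡⟨ sum-remove {i = i} g ⟩
  g i + sum (g ∘ punchIn i)     ≡⟨ cong (g i +_) (sum-zero (λ j → g0 _ (FinP.punchInᵢ≢i i j))) ⟩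
  g i + 0                       ≡⟨ ℕP.+-identityʳ (g i) ⟩
  g i                           ∎
  where open ≡-Reasoning

≤-foldr-⊔ : ∀ {x} {xs : List ℕ} → x ∈ˡ xs → x ≤ foldr _⊔_ 0 xs
≤-foldr-⊔ {x} x∈xs = ListP.foldr-preservesᵒ {P = x ≤_}
  (λ a b → [ (λ x≤a → ℕP.m≤n⇒m≤n⊔o b x≤a) , (λ x≤b → ℕP.m≤n⇒m≤o⊔n a x≤b) ]′)
  0 _ (inj₂ (Any.map ℕP.≤-reflexive x∈xs))

foldr-⊔-≤ : ∀ {b} {xs : List ℕ} → All (_≤ b) xs → foldr _⊔_ 0 xs ≤ b
foldr-⊔-≤ = ListP.foldr-preservesᵇ ℕP.⊔-lub z≤n

module _ (M : Matroid) where
  open Matroid M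

  ∈⇒∈cl : ∀ {e Y} → e ∈ Y → _∈cl_ M e Y
  ∈⇒∈cl {e} {Y} e∈Y = ℕP.≤-antisym (r-mono _ _ Y∪e⊆Y) (r-mono _ _ (p⊆p∪q ⁅ e ⁆))
    where
    Y∪e⊆Y : Y ∪ ⁅ e ⁆ ⊆ Y
    Y∪e⊆Y x∈ = [ id , (λ x∈e → subst (_∈ Y) (sym (x∈⁅y⁆⇒x≡y e x∈e)) e∈Y) ]′ (x∈p∪q⁻ Y ⁅ e ⁆ x∈)

  -- Submodularity applied to Z and Y ∪ {e}.
  ∈cl-mono : ∀ {e Y Z} → Y ⊆ Z → _∈cl_ M e Y → _∈cl_ M e Z
  ∈cl-mono {e} {Y} {Z} Y⊆Z e∈clY =
    ℕP.≤-antisym (ℕP.+-cancelʳ-≤ (r Y) _ _ bound) (r-mono _ _ (p⊆p∪q ⁅ e ⁆))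
    where
    Z∪e⊆ : Z ∪ ⁅ e ⁆ ⊆ Z ∪ (Y ∪ ⁅ e ⁆)
    Z∪e⊆ x∈ = [ p⊆p∪q _ , q⊆p∪q Z _ ∘ q⊆p∪q Y _ ]′ (x∈p∪q⁻ Z _ x∈)
    Y⊆ : Y ⊆ Z ∩ (Y ∪ ⁅ e ⁆)
    Y⊆ x∈ = x∈p∩q⁺ (Y⊆Z x∈ , p⊆p∪q _ x∈)
    bound : r (Z ∪ ⁅ e ⁆) + r Y ≤ r Z + r Y
    bound = begin
      r (Z ∪ ⁅ e ⁆) + r Y                          ≤⟨ ℕP.+-mono-≤ (r-mono _ _ Z∪e⊆) (r-mono _ _ Y⊆) ⟩
      r (Z ∪ (Y ∪ ⁅ e ⁆)) + r (Z ∩ (Y ∪ ⁅ e ⁆))    ≤⟨ r-sub Z (Y ∪ ⁅ e ⁆) ⟩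
      r Z + r (Y ∪ ⁅ e ⁆)                          ≡⟨ cong (r Z +_) e∈clY ⟩
      r Z + r Y                                    ∎
      where open ℕP.≤-Reasoning

  spanning⇒rM≤r : ∀ {Y} → (∀ e → _∈cl_ M e Y) → rM M ≤ r Y
  spanning⇒rM≤r {Y} span = begin
    r ⊤                  ≤⟨ r-mono _ _ (λ {x} _ → covers (allFin n) (∈-allFin x)) ⟩
    r (add (allFin n))   ≡⟨ r-add (allFin n) ⟩
    r Y                  ∎
    where
    open ℕP.≤-Reasoning
    add : List (Fin n) → Subset n
    add = foldr (λ e S → S ∪ ⁅ e ⁆) Y
    Y⊆add : ∀ es → Y ⊆ add es
    Y⊆add []       = id
    Y⊆add (e ∷ es) = p⊆p∪q _ ∘ Y⊆add es
    r-add : ∀ es → r (add es) ≡ r Y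
    r-add []       = refl
    r-add (e ∷ es) = trans (∈cl-mono (Y⊆add es) (span e)) (r-add es)
    covers : ∀ es {x} → x ∈ˡ es → x ∈ add es
    covers (e ∷ es) (Any.here refl) = q⊆p∪q _ _ (x∈⁅x⁆ e)
    covers (e ∷ es) (Any.there x∈)  = p⊆p∪q _ (covers es x∈)

  rd-mono : ∀ {A B} → A ⊆ B → rd M A ≤ rd M B
  rd-mono A⊆B = ℕP.∸-monoʳ-≤ (rM M) (r-mono _ _ (p⊆q⇒∁p⊇∁q A⊆B))

  rd≡0 : ∀ {B} → (∀ {e} → e ∈ B → _∈cl_ M e (∁ B)) → rd M B ≡ 0
  rd≡0 {B} B⊆cl∁B = ℕP.m≤n⇒m∸n≡0 (spanning⇒rM≤r span)
    where
    span : ∀ e → _∈cl_ M e (∁ B)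
    span e with e ∈ˢ? B
    ... | yes e∈B = B⊆cl∁B e∈B
    ... | no  e∉B = ∈⇒∈cl (x∉p⇒x∈∁p e∉B)

∈⇒T : ∀ {n} {p : Subset n} {x} → x ∈ p → T (lookup p x)
∈⇒T x∈p = subst T (sym (VecP.[]=⇒lookup x∈p)) tt

T⇒∈ : ∀ {n} {p : Subset n} {x} → T (lookup p x) → x ∈ p
T⇒∈ {p = p} {x} t = VecP.lookup⇒[]= x p (Equivalence.to T-≡ t)

Unique-lookup-≢ : ∀ {A : Set} {xs : List A} {i j} → Unique xs → i <ᶠ j → List.lookup xs i ≢ List.lookup xs j
Unique-lookup-≢ {xs = _ ∷ xs} {zero}  {suc j} (x∉ ∷ _) _         = All.lookup x∉ (∈-lookup j)
Unique-lookup-≢ {xs = _ ∷ xs} {suc i} {suc j} (_ ∷ u)  (s≤s i<j) = Unique-lookup-≢ u i<j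

Unique⇒length≤ : ∀ {m} {xs : List (Fin m)} → Unique xs → length xs ≤ m
Unique⇒length≤ {m} {xs} u with m ℕP.<? length xs
... | no  m≮len = ℕP.≮⇒≥ m≮len
... | yes m<len with FinP.pigeonhole m<len (List.lookup xs)
...   | i , j , i<j , same = contradiction same (Unique-lookup-≢ u i<j)

-- Walks and paths

record Edge {m} (G : Graph m) (x y : Fin m) : Set where
  constructor edge
  field adjacent : T (Graph.adj G x y)

edge? : ∀ {m} (G : Graph m) x y → Dec (Edge G x y)
edge? G x y = Dec.map′ edge Edge.adjacent (T? (Graph.adj G x y))

Walk : ∀ {m} → Graph m → Fin m → Fin m → Set
Walk G = Star (Edge G)

module _ {m} {G : Graph m} where
  open import Data.List.Membership.DecPropositional (_≟_ {m}) using (_∈?_)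

  after : ∀ {x y} → Walk G x y → List (Fin m)
  after ε                  = []
  after (_◅_ {j = z} _ w) = z ∷ after w

  vertices : ∀ {x y} → Walk G x y → List (Fin m)
  vertices {x} w = x ∷ after w

  IsPath : ∀ {x y} → Walk G x y → Set
  IsPath w = Unique (vertices w)

  end∈vertices : ∀ {x y} (w : Walk G x y) → y ∈ˡ vertices w
  end∈vertices ε       = Any.here refl
  end∈vertices (_ ◅ w) = Any.there (end∈vertices w)

  path-length : ∀ {x y} {w : Walk G x y} → IsPath w → length (after w) < m
  path-length = Unique⇒length≤

  dropTo : ∀ {x y z} (w : Walk G z y) → IsPath w → x ∈ˡ vertices w → Σ (Walk G x y) IsPath
  dropTo w       u       (Any.here refl) = w , u
  dropTo (_ ◅ w) (_ ∷ u) (Any.there x∈)  = dropTo w u x∈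

  takeTo : ∀ {x y z} (w : Walk G x z) → IsPath w → y ∈ˡ vertices w →
           Σ (Walk G x y) λ w′ → IsPath w′ × vertices w′ ⊆ˡ vertices w
  takeTo w             _        (Any.here refl) = ε , All.[] ∷ [] , λ { (Any.here refl) → Any.here refl }
  takeTo (e ◅ w) (x∉ ∷ u) (Any.there y∈) with takeTo w u y∈
  ... | w′ , u′ , sub = e ◅ w′ , AllP.anti-mono sub x∉ ∷ u′ , λ where
    (Any.here refl) → Any.here refl
    (Any.there v∈)  → Any.there (sub v∈)

  toPath : ∀ {x y} → Walk G x y → Σ (Walk G x y) IsPath
  toPath ε = ε , All.[] ∷ []
  toPath {x} (e ◅ w) with toPath w
  ... | p , u with x ∈? vertices p
  ...   | yes x∈ = dropTo p u x∈
  ...   | no  x∉ = e ◅ p , AllP.¬Any⇒All¬ _ x∉ ∷ u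

module _ {m} (G : Graph m) where
  open Graph G

  private
    Within : ℕ → Fin m → Fin m → Set
    Within k x y = T (lookup (reachWithin adj k x) y)

    grow : ∀ k {x y} → lookup (reachWithin adj (suc k) x) y ≡
           (lookup (reachWithin adj k x) y ∨ anyFin (λ z → lookup (reachWithin adj k x) z ∧ adj z y))
    grow k {x} {y} = VecP.lookup∘tabulate _ y

    stay⁺ : ∀ k {x y} → Within k x y → Within (suc k) x y
    stay⁺ k r = subst T (sym (grow k)) (Equivalence.from T-∨ (inj₁ r))

    step⁺ : ∀ k {x y z} → Within k x z → Edge G z y → Within (suc k) x y
    step⁺ k {z = z} r e = subst T (sym (grow k)) (Equivalence.from T-∨ (inj₂
      (AnyP.any⁺ _ (AnyP.tabulate⁺ z (Equivalence.from T-∧ (r , Edge.adjacent e))))))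

    step⁻ : ∀ k {x y} → Within (suc k) x y → Within k x y ⊎ ∃ λ z → Within k x z × Edge G z y
    step⁻ k r with Equivalence.to T-∨ (subst T (grow k) r)
    ... | inj₁ r′ = inj₁ r′
    ... | inj₂ t with AnyP.tabulate⁻ (AnyP.any⁻ _ _ t)
    ...   | z , rz with Equivalence.to T-∧ rz
    ...     | r , e = inj₂ (z , r , edge e)

    prepend : ∀ k {x y z} → Edge G x z → Within k z y → Within (suc k) x y
    prepend zero {x} {z = z} e r =
      subst (Within 1 x) (sym (x∈⁅y⁆⇒x≡y z (T⇒∈ r))) (step⁺ zero {x = x} (∈⇒T (x∈⁅x⁆ x)) e)
    prepend (suc k) e r with step⁻ k r
    ... | inj₁ r′           = stay⁺ (suc k) (prepend k e r′)
    ... | inj₂ (q , rq , f) = step⁺ (suc k) (prepend k e rq) f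

    within⇒walk : ∀ k {x y} → Within k x y → Walk G x y
    within⇒walk zero {x} r = subst (Walk G x) (sym (x∈⁅y⁆⇒x≡y x (T⇒∈ r))) ε
    within⇒walk (suc k) r with step⁻ k r
    ... | inj₁ r′           = within⇒walk k r′
    ... | inj₂ (z , rz , e) = within⇒walk k rz ◅◅ (e ◅ ε)

    walk⇒within : ∀ {x y} (w : Walk G x y) → Within (length (after w)) x y
    walk⇒within {x} ε = ∈⇒T (x∈⁅x⁆ x)
    walk⇒within (e ◅ w) = prepend (length (after w)) e (walk⇒within w)

    within-mono : ∀ {j k x y} → j ≤′ k → Within j x y → Within k x y
    within-mono ≤′-refl                    = id
    within-mono {k = suc k} (≤′-step j≤′k) = stay⁺ k ∘ within-mono j≤′k

  reach⇒walk : ∀ {x y} → T (lookup (reach adj x) y) → Walk G x y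
  reach⇒walk = within⇒walk m

  -- Reachability is only computed up to m steps, which suffices because paths are shorter.
  walk⇒reach : ∀ {x y} → Walk G x y → T (lookup (reach adj x) y)
  walk⇒reach w with toPath w
  ... | p , u = within-mono (ℕP.≤⇒≤′ (ℕP.<⇒≤ (path-length u))) (walk⇒within p)

-- Graph operations

module _ {m} (G : Graph m) where
  open Graph G

  isolateVertex : Fin m → Graph m
  isolateVertex v = record
    { adj       = adjMinusV G v
    ; adj-sym   = λ x y → trans (swap (outside x) (outside y) (adj x y))
                                (cong (λ b → outside y ∧ outside x ∧ b) (adj-sym x y))
    ; adj-irref = λ x → trans (cong (λ b → outside x ∧ outside x ∧ b) (adj-irref x))
                              (trans (cong (outside x ∧_) (∧-zeroʳ (outside x))) (∧-zeroʳ (outside x)))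
    }
    where
    outside : Fin m → Bool
    outside x = not ⌊ x ≟ v ⌋
    swap : ∀ a b c → a ∧ b ∧ c ≡ b ∧ a ∧ c
    swap a b c = trans (sym (∧-assoc a b c)) (trans (cong (_∧ c) (∧-comm a b)) (∧-assoc b a c))

  deleteEdge : Fin m → Fin m → Graph m
  deleteEdge u w = record
    { adj       = adjMinusE G u w
    ; adj-sym   = λ x y → cong₂ _∧_ (adj-sym x y) (cong not (mirror ⌊ x ≟ u ⌋ ⌊ y ≟ w ⌋ ⌊ x ≟ w ⌋ ⌊ y ≟ u ⌋))
    ; adj-irref = λ x → cong (_∧ _) (adj-irref x)
    }
    where
    mirror : ∀ a b c d → (a ∧ b) ∨ (c ∧ d) ≡ (d ∧ c) ∨ (b ∧ a)
    mirror a b c d = trans (∨-comm (a ∧ b) (c ∧ d)) (cong₂ _∨_ (∧-comm c d) (∧-comm a b))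

removeVertex : ∀ {m} → Graph (suc m) → Fin (suc m) → Graph m
removeVertex G ℓ = record
  { adj       = λ x y → adj (punchIn ℓ x) (punchIn ℓ y)
  ; adj-sym   = λ x y → adj-sym (punchIn ℓ x) (punchIn ℓ y)
  ; adj-irref = λ x → adj-irref (punchIn ℓ x)
  }
  where open Graph G

module _ {m} {G : Graph m} where
  open Graph G

  flip-edge : ∀ {x y} → Edge G x y → Edge G y x
  flip-edge (edge t) = edge (subst T (adj-sym _ _) t)

  reverse : ∀ {x y} → Walk G x y → Walk G y x
  reverse = Star.reverse flip-edge

  ¬self-edge : ∀ {x} → ¬ Edge G x x
  ¬self-edge {x} (edge t) = subst T (adj-irref x) t

  walk-chain : ∀ {x y z} (w : Walk G x y) → Edge G y z → Chain G (vertices w ∷ʳ z)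
  walk-chain ε        e = Edge.adjacent e , tt
  walk-chain (e′ ◅ w) e = Edge.adjacent e′ , walk-chain w e

  -- Closing a path of length ≥ 2 by an edge back to its start would give a cycle.
  acyclic-adjacent-ends⇒length<2 : Acyclic G → ∀ {x y} (w : Walk G x y) → IsPath w → Edge G y x →
                                   length (after w) < 2
  acyclic-adjacent-ends⇒length<2 acyclic {x} w isPath e with 2 ℕP.≤? length (after w)
  ... | yes 2≤len = ⊥-elim (acyclic x (after w) (2≤len , isPath , walk-chain w e))
  ... | no  2≰len = ℕP.≰⇒> 2≰len

  after-map : ∀ {H : Graph m} (f : ∀ {x y} → Edge H x y → Edge G x y) {x y} (w : Walk H x y) →
              after (Star.map f w) ≡ after w
  after-map f ε       = refl
  after-map f (e ◅ w) = cong (_ ∷_) (after-map f w)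

  isolateVertex-⊆ : ∀ {v x y} → Edge (isolateVertex G v) x y → Edge G x y
  isolateVertex-⊆ {v} {x} {y} (edge t) =
    edge (T-∧ʳ (not ⌊ y ≟ v ⌋) (T-∧ʳ (not ⌊ x ≟ v ⌋) t))

  isolateVertex-edge : ∀ {v x y} → x ≢ v → y ≢ v → Edge G x y → Edge (isolateVertex G v) x y
  isolateVertex-edge {v} {x} {y} x≢v y≢v (edge t) =
    edge (T-∧⁺ (fromWitnessFalse {a? = x ≟ v} x≢v) (T-∧⁺ (fromWitnessFalse {a? = y ≟ v} y≢v) t))

  isolated : ∀ {v y} → ¬ Edge (isolateVertex G v) v y
  isolated {v} {y} (edge t) = toWitnessFalse {a? = v ≟ v} (T-∧ˡ (not ⌊ v ≟ v ⌋) t) refl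

  walk-from-isolated : ∀ {v y} → Walk (isolateVertex G v) v y → y ≡ v
  walk-from-isolated ε       = refl
  walk-from-isolated (e ◅ _) = ⊥-elim (isolated e)

  deleteEdge-⊆ : ∀ {u w x y} → Edge (deleteEdge G u w) x y → Edge G x y
  deleteEdge-⊆ {x = x} {y} (edge t) = edge (T-∧ˡ (adj x y) t)

  deleteEdge-edge : ∀ {u w x y} → y ≢ u → y ≢ w → Edge G x y → Edge (deleteEdge G u w) x y
  deleteEdge-edge {u} {w} {x} {y} y≢u y≢w (edge t) =
    edge (T-∧⁺ t (T-not⁺ λ hit → [ miss y≢w , miss y≢u ]′ (T-∨⁻ (⌊ x ≟ u ⌋ ∧ ⌊ y ≟ w ⌋) hit)))
    where
    miss : ∀ {a b} → y ≢ b → ¬ T (⌊ x ≟ a ⌋ ∧ ⌊ y ≟ b ⌋)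
    miss {a} {b} y≢b t = y≢b (Dec.toWitness (T-∧ʳ ⌊ x ≟ a ⌋ t))

  deleteEdge-deletes : ∀ {u w} → ¬ Edge (deleteEdge G u w) u w
  deleteEdge-deletes {u} {w} (edge t) =
    T-not⁻ (T-∧ʳ (adj u w) t)
           (T-∨ˡ (T-∧⁺ (Dec.fromWitness {a? = u ≟ u} refl) (Dec.fromWitness {a? = w ≟ w} refl)))

-- Leaves of trees

record Leaf {m} (G : Graph m) (ℓ p : Fin m) : Set where
  field
    to-parent      : Edge G ℓ p
    only-neighbour : ∀ {y} → Edge G ℓ y → y ≡ p

module _ {m} {G : Graph m} (acyclic : Acyclic G) {u w} (uw : Edge G u w) where
  open import Data.List.Membership.DecPropositional (_≟_ {m}) using (_∈?_)

  private
    G∖uw : Graph m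
    G∖uw = deleteEdge G u w

  no-detour : ¬ Walk G∖uw u w
  no-detour detour with toPath detour
  ... | ε , _              = ¬self-edge uw
  ... | e ◅ ε , _          = deleteEdge-deletes e
  ... | p@(_ ◅ _ ◅ _) , isPath with acyclic-adjacent-ends⇒length<2 acyclic p′ p′Path (flip-edge uw)
    where
    p′ : Walk G u w
    p′ = Star.map deleteEdge-⊆ p
    p′Path : IsPath p′
    p′Path = subst (Unique ∘ (u ∷_)) (sym (after-map deleteEdge-⊆ p)) isPath
  ...   | s≤s (s≤s ())

  private
    Found : Set
    Found = ∃₂ λ ℓ p → Leaf G ℓ p × Walk G∖uw u ℓ

    -- Extend the path h, p, …, w at h while possible; then h is a leaf, as a second
    -- neighbour of h would close a cycle with the path. The path never exceeds m vertices.
    extend : ∀ fuel {h p} (e : Edge G h p) (q : Walk G p w) → IsPath (e ◅ q) →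
             u ∈ˡ vertices (e ◅ q) → Walk G∖uw u h → m ≤ fuel + length (vertices (e ◅ q)) → Found
    extend fuel {h} {p} e q isPath u∈ walk bound
      with FinP.any? (λ z → edge? G h z ×-dec ¬? (z ∈? vertices (e ◅ q)))
    ... | yes (z , hz , z∉) with fuel
    ...   | zero = contradiction (Unique⇒length≤ longer) (ℕP.<⇒≱ (s≤s bound))
      where longer : Unique (z ∷ vertices (e ◅ q))
            longer = AllP.¬Any⇒All¬ _ z∉ ∷ isPath
    ...   | suc fuel′ =
      extend fuel′ (flip-edge hz) (e ◅ q) (AllP.¬Any⇒All¬ _ z∉ ∷ isPath) (Any.there u∈)
        (walk ◅◅ (deleteEdge-edge (λ { refl → z∉ u∈ }) (λ { refl → z∉ (Any.there (end∈vertices q)) }) hz ◅ ε))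
        (subst (m ≤_) (sym (ℕP.+-suc fuel′ _)) bound)
    extend fuel {h} {p} e q isPath@(h∉q ∷ qPath) u∈ walk bound | no stuck =
      h , p , record { to-parent = e ; only-neighbour = neighbour } , walk
      where
      neighbour : ∀ {y} → Edge G h y → y ≡ p
      neighbour {y} hy with y ∈? vertices (e ◅ q)
      ... | no  y∉ = ⊥-elim (stuck (y , hy , y∉))
      ... | yes (Any.here refl) = ⊥-elim (¬self-edge hy)
      ... | yes (Any.there y∈q) with takeTo q qPath y∈q
      ...   | ε , _ , _ = refl
      ...   | q′@(_ ◅ _) , q′Path , q′⊆q
              with acyclic-adjacent-ends⇒length<2 acyclic (e ◅ q′) (AllP.anti-mono q′⊆q h∉q ∷ q′Path) (flip-edge hy)
      ...     | s≤s (s≤s ())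

  leaf-on-side : ∃₂ λ ℓ p → Leaf G ℓ p × Walk (deleteEdge G u w) u ℓ
  leaf-on-side = extend m uw ε ((u≢w All.∷ All.[]) ∷ All.[] ∷ []) (Any.here refl) ε (ℕP.m≤m+n m 2)
    where
    u≢w : u ≢ w
    u≢w refl = ¬self-edge uw

-- Removing a leaf

module _ {m} {G : Graph (suc m)} {ℓ p} (pendant : ∀ {y} → Edge G ℓ y → y ≡ p) where
  open Graph G

  -- A walk entering ℓ must come from p and return to p at once, so the detour can be cut out.
  skip-leaf : ∀ {x y x′ y′} → Walk G x y → punchIn ℓ x′ ≡ x → punchIn ℓ y′ ≡ y →
              Walk (removeVertex G ℓ) x′ y′
  skip-leaf ε refl y′↦ = subst (Walk _ _) (FinP.punchIn-injective ℓ _ _ (sym y′↦)) ε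
  skip-leaf {x′ = x′} (_◅_ {j = z} e w) refl y′↦ with ℓ ≟ z
  ... | no ℓ≢z = edge (subst (T ∘ adj (punchIn ℓ x′)) (sym (FinP.punchIn-punchOut ℓ≢z)) (Edge.adjacent e))
                 ◅ skip-leaf w (FinP.punchIn-punchOut ℓ≢z) y′↦
  ... | yes refl with w
  ...   | ε       = ⊥-elim (FinP.punchInᵢ≢i ℓ _ y′↦)
  ...   | f ◅ w′ = skip-leaf w′ (trans (pendant (flip-edge e)) (sym (pendant f))) y′↦

lift-walk : ∀ {m} {G : Graph (suc m)} ℓ {x y} → Walk (removeVertex G ℓ) x y → Walk G (punchIn ℓ x) (punchIn ℓ y)
lift-walk ℓ = Star.gmap (punchIn ℓ) λ (edge t) → edge t

removeVertex-acyclic : ∀ {m} {G : Graph (suc m)} ℓ → Acyclic G → Acyclic (removeVertex G ℓ)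
removeVertex-acyclic {G = G} ℓ acyclic x xs (2≤len , unique , chain) =
  acyclic (punchIn ℓ x) (map (punchIn ℓ) xs)
    ( subst (2 ≤_) (sym (ListP.length-map _ xs)) 2≤len
    , UniqueP.map⁺ (FinP.punchIn-injective ℓ _ _) unique
    , subst (Chain G) (ListP.map-++ (punchIn ℓ) (x ∷ xs) (x ∷ [])) (lift-chain _ chain))
  where
  lift-chain : ∀ xs → Chain (removeVertex G ℓ) xs → Chain G (map (punchIn ℓ) xs)
  lift-chain []           _         = tt
  lift-chain (_ ∷ [])     _         = tt
  lift-chain (_ ∷ y ∷ ys) (t , rest) = t , lift-chain (y ∷ ys) rest

removeLeaf-isTree : ∀ {m} {G : Graph (suc m)} {ℓ p} → Leaf G ℓ p → IsTree G → IsTree (removeVertex G ℓ)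
removeLeaf-isTree {G = G} {ℓ} leaf (connected , acyclic) =
  (λ x y → T⇒∈ (walk⇒reach _ (skip-leaf (Leaf.only-neighbour leaf)
                                 (reach⇒walk G (∈⇒T (connected (punchIn ℓ x) (punchIn ℓ y)))) refl refl)))
  , removeVertex-acyclic ℓ acyclic

-- Sums over least representatives of classes

Least : ∀ {n} → (Fin n → Bool) → Fin n → Set
Least s x = T (s x) × (∀ y → y <ᶠ x → ¬ T (s y))

least : ∀ {n} (s : Fin n → Bool) → ∃ (T ∘ s) → ∃ (Least s)
least {suc n} s found with T? (s zero)
... | yes s0 = zero , s0 , λ _ ()
... | no ¬s0 with least (s ∘ suc) (shift found)
  where
  shift : ∃ (T ∘ s) → ∃ (T ∘ s ∘ suc)
  shift (zero  , s0) = ⊥-elim (¬s0 s0)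
  shift (suc x , sx) = x , sx
...   | x , sx , minimal = suc x , sx , λ { zero _ → ¬s0 ; (suc y) (s≤s y<x) → minimal y y<x }

least-unique : ∀ {n} {s : Fin n → Bool} {x y} → Least s x → Least s y → x ≡ y
least-unique {x = x} {y} (sx , min-x) (sy , min-y) with FinP.<-cmp x y
... | tri< x<y _ _ = ⊥-elim (min-y x x<y sx)
... | tri≈ _ x≡y _ = x≡y
... | tri> _ _ y<x = ⊥-elim (min-x y y<x sy)

punchIn-mono-< : ∀ {n} (ℓ : Fin (suc n)) {a b} → a <ᶠ b → punchIn ℓ a <ᶠ punchIn ℓ b
punchIn-mono-< ℓ {a} {b} a<b = ℕP.≤∧≢⇒< (FinP.punchIn-mono-≤ ℓ a b (ℕP.<⇒≤ a<b))
  (ℕP.<⇒≢ a<b ∘ cong toℕ ∘ FinP.punchIn-injective ℓ a b ∘ FinP.toℕ-injective)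

punchIn-cancel-< : ∀ {n} (ℓ : Fin (suc n)) {a b} → punchIn ℓ a <ᶠ punchIn ℓ b → a <ᶠ b
punchIn-cancel-< ℓ {a} {b} lt = ℕP.≤∧≢⇒< (FinP.punchIn-cancel-≤ ℓ a b (ℕP.<⇒≤ lt))
  (ℕP.<⇒≢ lt ∘ cong (toℕ ∘ punchIn ℓ) ∘ FinP.toℕ-injective)

-- R x is the class of x and act marks the classified elements; each class is counted once,
-- at its least element.
module _ {N : ℕ} (act : Fin N → Bool) (R : Fin N → Fin N → Bool) where

  isRepOf : Fin N → Bool
  isRepOf x = act x ∧ all (λ y → not (⌊ y <? x ⌋ ∧ R x y)) (allFin N)

  sumOverReps : (Fin N → ℕ) → ℕ
  sumOverReps g = foldr _+_ 0 (map (λ x → if isRepOf x then g x else 0) (allFin N))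

  isRepOf⁻ : ∀ {x} → T (isRepOf x) → T (act x) × (∀ y → y <ᶠ x → ¬ T (R x y))
  isRepOf⁻ {x} t = T-∧ˡ (act x) t , λ y y<x rxy →
    T-not⁻ (AllP.tabulate⁻ (AllP.all⁺ _ (allFin N) (T-∧ʳ (act x) t)) y)
           (T-∧⁺ (Dec.fromWitness {a? = y <? x} y<x) rxy)

  isRepOf⁺ : ∀ {x} → T (act x) → (∀ y → y <ᶠ x → ¬ T (R x y)) → T (isRepOf x)
  isRepOf⁺ {x} ax minimal = T-∧⁺ ax (AllP.all⁻ _ (AllP.tabulate⁺ λ y → T-not⁺ λ t →
    minimal y (Dec.toWitness {a? = y <? x} (T-∧ˡ ⌊ y <? x ⌋ t)) (T-∧ʳ ⌊ y <? x ⌋ t)))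

  ¬isRepOf⇒smaller : ∀ {x} → T (act x) → ¬ T (isRepOf x) → ∃ λ y → y <ᶠ x × T (R x y)
  ¬isRepOf⇒smaller {x} ax ¬rep with FinP.any? (λ y → (y <? x) ×-dec T? (R x y))
  ... | yes found = found
  ... | no  none  = ⊥-elim (¬rep (isRepOf⁺ ax λ y y<x rxy → none (y , y<x , rxy)))

sumOverReps-cong : ∀ {N} {act act′ : Fin N → Bool} {R R′ : Fin N → Fin N → Bool} {g g′ : Fin N → ℕ} →
                   (∀ x → act x ≡ act′ x) → (∀ x y → R x y ≡ R′ x y) → (∀ x → T (act x) → g x ≡ g′ x) →
                   sumOverReps act R g ≡ sumOverReps act′ R′ g′
sumOverReps-cong {N} {act} {act′} {R} {R′} {g} {g′} act≡ R≡ g≡ = begin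
  sumOverReps act R g    ≡⟨ sum-allFin term ⟩
  sum term               ≡⟨ sum-cong-≗ term≗term′ ⟩
  sum term′              ≡⟨ sum-allFin term′ ⟨
  sumOverReps act′ R′ g′ ∎
  where
  open ≡-Reasoning
  term term′ : Fin N → ℕ
  term  x = if isRepOf act R x then g x else 0
  term′ x = if isRepOf act′ R′ x then g′ x else 0
  rep⇒rep′ : ∀ {x} → T (isRepOf act R x) → T (isRepOf act′ R′ x)
  rep⇒rep′ r with isRepOf⁻ act R r
  ... | ax , minimal = isRepOf⁺ act′ R′ (subst T (act≡ _) ax) λ y y<x → minimal y y<x ∘ subst T (sym (R≡ _ y))
  rep′⇒rep : ∀ {x} → T (isRepOf act′ R′ x) → T (isRepOf act R x)
  rep′⇒rep r with isRepOf⁻ act′ R′ r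
  ... | ax , minimal = isRepOf⁺ act R (subst T (sym (act≡ _)) ax) λ y y<x → minimal y y<x ∘ subst T (R≡ _ y)
  term≗term′ : ∀ x → term x ≡ term′ x
  term≗term′ x with T? (isRepOf act R x)
  ... | yes r = trans (if-T r) (trans (g≡ x (proj₁ (isRepOf⁻ act R r))) (sym (if-T (rep⇒rep′ r))))
  ... | no ¬r = trans (if-¬T ¬r) (sym (if-¬T (¬r ∘ rep′⇒rep)))

module _ {K : ℕ} (ℓ : Fin (suc K)) {act : Fin (suc K) → Bool} {R : Fin (suc K) → Fin (suc K) → Bool}
         {g : Fin (suc K) → ℕ}
         (R-refl     : ∀ {x} → T (act x) → T (R x x))
         (R-trans    : ∀ {x y} → T (act x) → T (R x y) → ∀ z → R y z ≡ R x z)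
         (act-closed : ∀ {x y} → T (act x) → T (R x y) → T (act y))
         (g-class    : ∀ {x y} → T (act x) → T (R x y) → g y ≡ g x)
         (lonely     : T (act ℓ) → (∀ y → ¬ T (R ℓ (punchIn ℓ y))) → g ℓ ≡ 0)
         where
  -- Deleting ℓ loses a class only when that class is {ℓ}, which `lonely` makes weightless.

  private
    pI : Fin K → Fin (suc K)
    pI = punchIn ℓ

    act′ : Fin K → Bool
    act′ = act ∘ pI

    R′ : Fin K → Fin K → Bool
    R′ x y = R (pI x) (pI y)

    rep : Fin (suc K) → Bool
    rep = isRepOf act R

    rep′ : Fin K → Bool
    rep′ = isRepOf act′ R′

    R-sym : ∀ {x y} → T (act x) → T (R x y) → T (R y x)
    R-sym ax rxy = subst T (sym (R-trans ax rxy _)) (R-refl ax)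

    rep′-minimal : ∀ {x} → T (rep′ x) → ∀ y → y <ᶠ pI x → y ≢ ℓ → ¬ T (R (pI x) y)
    rep′-minimal {x} r y y<x y≢ℓ =
      subst (λ z → ¬ T (R (pI x) z)) (FinP.punchIn-punchOut (y≢ℓ ∘ sym))
        (proj₂ (isRepOf⁻ act′ R′ r) _
          (punchIn-cancel-< ℓ (subst (_<ᶠ pI x) (sym (FinP.punchIn-punchOut (y≢ℓ ∘ sym))) y<x)))

    rep⇒rep′ : ∀ {x} → T (rep (pI x)) → T (rep′ x)
    rep⇒rep′ r with isRepOf⁻ act R r
    ... | ax , minimal = isRepOf⁺ act′ R′ ax λ y y<x → minimal (pI y) (punchIn-mono-< ℓ y<x)

    new-rep-in-class-of-ℓ : ∀ {x} → T (rep′ x) → ¬ T (rep (pI x)) → T (R (pI x) ℓ) × ℓ <ᶠ pI x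
    new-rep-in-class-of-ℓ r ¬r with ¬isRepOf⇒smaller act R (proj₁ (isRepOf⁻ act′ R′ r)) ¬r
    ... | y , y<x , rxy with y ≟ ℓ
    ...   | yes refl = rxy , y<x
    ...   | no  y≢ℓ  = ⊥-elim (rep′-minimal r y y<x y≢ℓ rxy)

    new : Fin K → Bool
    new x = rep′ x ∧ not (rep (pI x))

    inClassOfℓ : Fin K → Bool
    inClassOfℓ x = R ℓ (pI x)

    new⇒least : ∀ {x} → T (new x) → T (rep ℓ) × Least inClassOfℓ x
    new⇒least {x} t with T-∧ˡ (rep′ x) t | T-not⁻ (T-∧ʳ (rep′ x) t)
    ... | r | ¬r with new-rep-in-class-of-ℓ r ¬r
    ...   | rxℓ , ℓ<x =
      isRepOf⁺ act R (act-closed ax rxℓ)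
        (λ y y<ℓ rℓy → rep′-minimal r y (ℕP.<-trans y<ℓ ℓ<x) (λ { refl → ℕP.<-irrefl refl y<ℓ })
                                   (subst T (R-trans ax rxℓ y) rℓy))
      , R-sym ax rxℓ
      , λ y y<x sy → proj₂ (isRepOf⁻ act′ R′ r) y y<x (subst T (R-trans ax rxℓ (pI y)) sy)
      where ax = proj₁ (isRepOf⁻ act′ R′ r)

    least⇒new : ∀ {x} → T (rep ℓ) → Least inClassOfℓ x → T (new x)
    least⇒new {x} rℓ (sx , minimal) with isRepOf⁻ act R rℓ
    ... | aℓ , ℓ-minimal = T-∧⁺ r′ (T-not⁺ λ r → proj₂ (isRepOf⁻ act R r) ℓ ℓ<x (R-sym aℓ sx))
      where
      r′ : T (rep′ x)
      r′ = isRepOf⁺ act′ R′ (act-closed aℓ sx) λ y y<x r → minimal y y<x (subst T (R-trans aℓ sx (pI y)) r)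
      ℓ<x : ℓ <ᶠ pI x
      ℓ<x with FinP.<-cmp ℓ (pI x)
      ... | tri< lt _ _ = lt
      ... | tri≈ _ eq _ = ⊥-elim (FinP.punchInᵢ≢i ℓ x (sym eq))
      ... | tri> _ _ gt = ⊥-elim (ℓ-minimal (pI x) gt sx)

    term : Fin (suc K) → ℕ
    term x = if rep x then g x else 0

    term′ : Fin K → ℕ
    term′ x = if rep′ x then g (pI x) else 0

    extra : Fin K → ℕ
    extra x = if new x then g ℓ else 0

    term′≡ : ∀ x → term′ x ≡ term (pI x) + extra x
    term′≡ x with T? (rep (pI x)) | T? (rep′ x)
    ... | yes r | _ = begin
      term′ x                   ≡⟨ if-T (rep⇒rep′ r) ⟩
      g (pI x)                  ≡⟨ ℕP.+-identityʳ _ ⟨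
      g (pI x) + 0              ≡⟨ cong₂ _+_ (if-T r) (if-¬T (λ n → T-not⁻ (T-∧ʳ (rep′ x) n) r)) ⟨
      term (pI x) + extra x     ∎
      where open ≡-Reasoning
    ... | no ¬r | yes r′ = begin
      term′ x                   ≡⟨ if-T r′ ⟩
      g (pI x)                  ≡⟨ g-class (proj₁ (isRepOf⁻ act′ R′ r′)) (proj₁ (new-rep-in-class-of-ℓ r′ ¬r)) ⟨
      g ℓ                       ≡⟨ cong₂ _+_ (if-¬T ¬r) (if-T (T-∧⁺ r′ (T-not⁺ ¬r))) ⟨
      term (pI x) + extra x     ∎
      where open ≡-Reasoning
    ... | no ¬r | no ¬r′ = trans (if-¬T ¬r′) (sym (cong₂ _+_ (if-¬T ¬r) (if-¬T (¬r′ ∘ T-∧ˡ (rep′ x)))))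

    extra≡0 : ∀ {x} → ¬ (T (rep ℓ) × Least inClassOfℓ x) → extra x ≡ 0
    extra≡0 h = if-¬T (h ∘ new⇒least)

    -- Exactly the least element of ℓ's remaining class becomes a new representative, and only if ℓ was one.
    sum-extra : sum extra ≡ term ℓ
    sum-extra with T? (rep ℓ)
    ... | no ¬rℓ = trans (sum-zero {g = extra} (λ x → extra≡0 (¬rℓ ∘ proj₁))) (sym (if-¬T ¬rℓ))
    ... | yes rℓ with FinP.any? (λ x → T? (inClassOfℓ x))
    ...   | no none = begin
      sum extra  ≡⟨ sum-zero {g = extra} (λ x → extra≡0 (λ (_ , sx , _) → none (x , sx))) ⟩
      0          ≡⟨ lonely (proj₁ (isRepOf⁻ act R rℓ)) (λ y sy → none (y , sy)) ⟨
      g ℓ        ≡⟨ if-T rℓ ⟨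
      term ℓ     ∎
      where open ≡-Reasoning
    ...   | yes found with least inClassOfℓ found
    ...     | x₀ , x₀-least = begin
      sum extra  ≡⟨ sum-zero-except {g = extra} x₀ (λ x x≢x₀ →
                      extra≡0 (λ (_ , x-least) → x≢x₀ (least-unique x-least x₀-least))) ⟩
      extra x₀   ≡⟨ if-T (least⇒new rℓ x₀-least) ⟩
      g ℓ        ≡⟨ if-T rℓ ⟨
      term ℓ     ∎
      where open ≡-Reasoning

  sumOverReps-punchIn : sumOverReps act R g ≡ sumOverReps act′ R′ (g ∘ pI)
  sumOverReps-punchIn = begin
    sumOverReps act R g                 ≡⟨ sum-allFin term ⟩
    sum term                            ≡⟨ sum-remove {i = ℓ} term ⟩
    term ℓ + sum (term ∘ pI)            ≡⟨ cong (_+ sum (term ∘ pI)) sum-extra ⟨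
    sum extra + sum (term ∘ pI)         ≡⟨ ℕP.+-comm (sum extra) _ ⟩
    sum (term ∘ pI) + sum extra         ≡⟨ ∑-distrib-+ (term ∘ pI) extra ⟨
    sum (λ x → term (pI x) + extra x)   ≡⟨ sum-cong-≗ term′≡ ⟨
    sum term′                           ≡⟨ sum-allFin term′ ⟨
    sumOverReps act′ R′ (g ∘ pI)        ∎
    where open ≡-Reasoning

-- Tree-decompositions

module _ {M : Matroid} (D : TreeDec M) where
  open TreeDec D

  ∈preimage⁻ : ∀ {C e} → e ∈ preimage D C → T (lookup C (τ e))
  ∈preimage⁻ {C} {e} e∈ = subst T (VecP.lookup∘tabulate _ e) (∈⇒T e∈)

  ∈preimage⁺ : ∀ {C e} → T (lookup C (τ e)) → e ∈ preimage D C
  ∈preimage⁺ {C} {e} t = T⇒∈ (subst T (sym (VecP.lookup∘tabulate _ e)) t)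

  -- The bag of a node on u's side of uw lies in U ⊆ cl(W), and W avoids that node.
  side-bag-rd≡0 : ∀ {u w ℓ} → Edge T-gr u w →
                  (∀ e → e ∈ displayU D u w → _∈cl_ M e (displayW D u w)) →
                  Walk (deleteEdge T-gr u w) u ℓ → rd M (preimage D ⁅ ℓ ⁆) ≡ 0
  side-bag-rd≡0 {u} {w} {ℓ} uw U⊆clW u⇝ℓ = rd≡0 M λ e∈bag → ∈cl-mono M W⊆∁bag (U⊆clW _ (bag⊆U e∈bag))
    where
    G∖uw : Graph (vcount D)
    G∖uw = deleteEdge T-gr u w
    side : Fin (vcount D) → Subset (vcount D)
    side = reach (Graph.adj G∖uw)
    bag : Subset (Matroid.n M)
    bag = preimage D ⁅ ℓ ⁆
    in-bag : ∀ {e} → e ∈ bag → τ e ≡ ℓ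
    in-bag e∈ = x∈⁅y⁆⇒x≡y ℓ (T⇒∈ (∈preimage⁻ {C = ⁅ ℓ ⁆} e∈))
    bag⊆U : bag ⊆ displayU D u w
    bag⊆U e∈ = ∈preimage⁺ {C = side u} (subst (T ∘ lookup (side u)) (sym (in-bag e∈)) (walk⇒reach G∖uw u⇝ℓ))
    W⊆∁bag : displayW D u w ⊆ ∁ bag
    W⊆∁bag {e} e∈W = x∉p⇒x∈∁p λ e∈bag → no-detour (proj₂ T-tree) uw
      (u⇝ℓ ◅◅ reverse (subst (Walk G∖uw w) (in-bag e∈bag) (reach⇒walk G∖uw (∈preimage⁻ {C = side w} e∈W))))

sumRd≡sumOverReps : ∀ {M} (D : TreeDec M) v →
                    sumRd D v ≡ sumOverReps (λ x → not ⌊ x ≟ v ⌋) (λ x → lookup (compMinusV D v x))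
                                            (λ x → rd M (preimage D (compMinusV D v x)))
sumRd≡sumOverReps D v = refl

width-mono : ∀ {M} (D D′ : TreeDec M) (f : Fin (vcount D′) → Fin (vcount D)) →
             (∀ v → nodeWidth D′ v ≡ nodeWidth D (f v)) → width D′ ≤ width D
width-mono D D′ f same = foldr-⊔-≤ (AllP.map⁺ {f = nodeWidth D′} (AllP.tabulate⁺ {f = id} bounded))
  where
  bounded : ∀ v → nodeWidth D′ v ≤ width D
  bounded v = subst (_≤ width D) (sym (same v)) (≤-foldr-⊔ (∈-map⁺ (nodeWidth D) (∈-allFin (f v))))

module DeleteLeaf (M : Matroid) {K} (G : Graph (suc (suc K))) (tree : IsTree G)
                  (τ : Fin (Matroid.n M) → Fin (suc (suc K))) {ℓ p} (leaf : Leaf G ℓ p) where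

  D : TreeDec M
  D = record { k = suc K ; T-gr = G ; T-tree = tree ; τ = τ }

  private
    pI : Fin (suc K) → Fin (suc (suc K))
    pI = punchIn ℓ

    G′ : Graph (suc K)
    G′ = removeVertex G ℓ

    ℓ≢p : ℓ ≢ p
    ℓ≢p refl = ¬self-edge (Leaf.to-parent leaf)

    pendant : ∀ {v y} → Edge (isolateVertex G v) ℓ y → y ≡ p
    pendant = Leaf.only-neighbour leaf ∘ isolateVertex-⊆

  relabel : Fin (suc (suc K)) → Fin (suc K)
  relabel t with ℓ ≟ t
  ... | yes _   = punchOut ℓ≢p
  ... | no ℓ≢t = punchOut ℓ≢t

  punchIn-relabel : ∀ t → pI (relabel t) ≡ t ⊎ (ℓ ≡ t × pI (relabel t) ≡ p)
  punchIn-relabel t with ℓ ≟ t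
  ... | yes ℓ≡t = inj₂ (ℓ≡t , FinP.punchIn-punchOut ℓ≢p)
  ... | no  ℓ≢t = inj₁ (FinP.punchIn-punchOut ℓ≢t)

  D′ : TreeDec M
  D′ = record { k = K ; T-gr = G′ ; T-tree = removeLeaf-isTree leaf tree ; τ = relabel ∘ τ }

  private
    comp : Fin (suc (suc K)) → Fin (suc (suc K)) → Fin (suc (suc K)) → Bool
    comp v x = lookup (compMinusV D v x)

    comp′ : Fin (suc K) → Fin (suc K) → Fin (suc K) → Bool
    comp′ v x = lookup (compMinusV D′ v x)

    comp⇒walk : ∀ {v} x y → T (comp v x y) → Walk (isolateVertex G v) x y
    comp⇒walk {v} x y = reach⇒walk (isolateVertex G v)

    walk⇒comp : ∀ {v x y} → Walk (isolateVertex G v) x y → T (comp v x y)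
    walk⇒comp {v} = walk⇒reach (isolateVertex G v)

    comp-trans : ∀ {v x y} → T (comp v x y) → ∀ z → comp v y z ≡ comp v x z
    comp-trans {v} {x} {y} xy z = T-ext
      (λ yz → walk⇒comp (comp⇒walk x y xy ◅◅ comp⇒walk y z yz))
      (λ xz → walk⇒comp (reverse (comp⇒walk x y xy) ◅◅ comp⇒walk x z xz))

    comp-avoids : ∀ {v x y} → x ≢ v → T (comp v x y) → y ≢ v
    comp-avoids {v} {x} {y} x≢v xy refl = x≢v (walk-from-isolated {G = G} (reverse (comp⇒walk x y xy)))

    comp-parent : ∀ {v x} → v ≢ ℓ → x ≢ v → x ≢ ℓ → comp v x ℓ ≡ comp v x p
    comp-parent {v} {x} v≢ℓ x≢v x≢ℓ = T-ext to-parent from-parent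
      where
      to-parent : T (comp v x ℓ) → T (comp v x p)
      to-parent xℓ with reverse (comp⇒walk x ℓ xℓ)
      ... | ε     = ⊥-elim (x≢ℓ refl)
      ... | e ◅ w = walk⇒comp (reverse (subst (λ z → Walk _ z x) (pendant e) w))
      from-parent : T (comp v x p) → T (comp v x ℓ)
      from-parent xp with p ≟ v
      ... | yes refl = ⊥-elim (comp-avoids x≢v xp refl)
      ... | no  p≢v  = walk⇒comp (comp⇒walk x p xp ◅◅
                         isolateVertex-edge p≢v (v≢ℓ ∘ sym) (flip-edge (Leaf.to-parent leaf)) ◅ ε)

    ≟-punchIn : ∀ a b → ⌊ a ≟ b ⌋ ≡ ⌊ pI a ≟ pI b ⌋
    ≟-punchIn a b = T-ext (λ t → Dec.fromWitness (cong pI (Dec.toWitness t)))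
                          (λ t → Dec.fromWitness (FinP.punchIn-injective ℓ a b (Dec.toWitness t)))

    -- Paths between the remaining vertices never pass through the leaf.
    comp-removeLeaf : ∀ v x y → comp′ v x y ≡ comp (pI v) (pI x) (pI y)
    comp-removeLeaf v x y = T-ext
      (λ r → walk⇒reach (isolateVertex G (pI v)) (lift-walk ℓ (Star.map reorder (reach⇒walk (isolateVertex G′ v) r))))
      (λ r → walk⇒reach (isolateVertex G′ v)
               (Star.map reorder⁻ (skip-leaf pendant (reach⇒walk (isolateVertex G (pI v)) r) refl refl)))
      where
      same-adj : ∀ a b → adjMinusV G′ v a b ≡ adjMinusV G (pI v) (pI a) (pI b)
      same-adj a b = cong₂ (λ s t → not s ∧ not t ∧ Graph.adj G (pI a) (pI b)) (≟-punchIn a v) (≟-punchIn b v)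
      reorder : ∀ {a b} → Edge (isolateVertex G′ v) a b → Edge (removeVertex (isolateVertex G (pI v)) ℓ) a b
      reorder {a} {b} (edge t) = edge (subst T (same-adj a b) t)
      reorder⁻ : ∀ {a b} → Edge (removeVertex (isolateVertex G (pI v)) ℓ) a b → Edge (isolateVertex G′ v) a b
      reorder⁻ {a} {b} (edge t) = edge (subst T (sym (same-adj a b)) t)

    preimage-removeLeaf : ∀ v x → x ≢ v → preimage D′ (compMinusV D′ v x) ≡ preimage D (compMinusV D (pI v) (pI x))
    preimage-removeLeaf v x x≢v = VecP.tabulate-cong λ e → trans (comp-removeLeaf v x (relabel (τ e))) (moved (τ e))
      where
      moved : ∀ t → comp (pI v) (pI x) (pI (relabel t)) ≡ comp (pI v) (pI x) t
      moved t with punchIn-relabel t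
      ... | inj₁ same          = cong (comp (pI v) (pI x)) same
      ... | inj₂ (refl , to-p) = trans (cong (comp (pI v) (pI x)) to-p)
          (sym (comp-parent (FinP.punchInᵢ≢i ℓ v) (x≢v ∘ FinP.punchIn-injective ℓ x v) (FinP.punchInᵢ≢i ℓ x)))

  sumRd-removeLeaf : rd M (preimage D ⁅ ℓ ⁆) ≡ 0 → ∀ v → sumRd D′ v ≡ sumRd D (pI v)
  sumRd-removeLeaf bag≡0 v = begin
    sumRd D′ v                                        ≡⟨ sumRd≡sumOverReps D′ v ⟩
    sumOverReps act′ (comp′ v) g′                     ≡⟨ sumOverReps-cong act′≡ (comp-removeLeaf v) g′≡ ⟩
    sumOverReps (act ∘ pI) (λ x y → R (pI x) (pI y)) (g ∘ pI)
      ≡⟨ sumOverReps-punchIn ℓ {act} {R} {g} (λ {x} _ → walk⇒comp {pI v} {x} ε)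
           (λ {x} {y} _ xy → comp-trans {pI v} {x} {y} xy)
           (λ {x} {y} x≢v xy → fromWitnessFalse (comp-avoids {pI v} {x} {y} (toWitnessFalse x≢v) xy))
           (λ {x} {y} _ xy → cong (rd M) (VecP.tabulate-cong λ e → comp-trans {pI v} {x} {y} xy (τ e)))
           (λ _ alone → ℕP.n≤0⇒n≡0 (subst (g ℓ ≤_) bag≡0 (rd-mono M (only-bag alone)))) ⟨
    sumOverReps act R g                               ≡⟨ sumRd≡sumOverReps D (pI v) ⟨
    sumRd D (pI v)                                    ∎
    where
    open ≡-Reasoning
    act : Fin (suc (suc K)) → Bool
    act x = not ⌊ x ≟ pI v ⌋
    R : Fin (suc (suc K)) → Fin (suc (suc K)) → Bool
    R = comp (pI v)
    g : Fin (suc (suc K)) → ℕ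
    g x = rd M (preimage D (compMinusV D (pI v) x))
    act′ : Fin (suc K) → Bool
    act′ x = not ⌊ x ≟ v ⌋
    g′ : Fin (suc K) → ℕ
    g′ x = rd M (preimage D′ (compMinusV D′ v x))
    act′≡ : ∀ x → act′ x ≡ act (pI x)
    act′≡ x = cong not (≟-punchIn x v)
    g′≡ : ∀ x → T (act′ x) → g′ x ≡ g (pI x)
    g′≡ x x≢v = cong (rd M) (preimage-removeLeaf v x (toWitnessFalse x≢v))
    only-bag : (∀ y → ¬ T (R ℓ (pI y))) → preimage D (compMinusV D (pI v) ℓ) ⊆ preimage D ⁅ ℓ ⁆
    only-bag alone {e} e∈ with ℓ ≟ τ e
    ... | yes ℓ≡τe = ∈preimage⁺ D {C = ⁅ ℓ ⁆} (∈⇒T (subst (_∈ ⁅ ℓ ⁆) ℓ≡τe (x∈⁅x⁆ ℓ)))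
    ... | no  ℓ≢τe = ⊥-elim (alone _ (subst (T ∘ R ℓ) (sym (FinP.punchIn-punchOut ℓ≢τe))
                                            (∈preimage⁻ D {C = compMinusV D (pI v) ℓ} e∈)))

  width-removeLeaf : rd M (preimage D ⁅ ℓ ⁆) ≡ 0 → width D′ ≤ width D
  width-removeLeaf bag≡0 = width-mono D D′ pI (cong (rM M ∸_) ∘ sumRd-removeLeaf bag≡0)

lemma3p1 : (M : Matroid) (D : TreeDec M) (u w : Fin (vcount D)) →
    isEdge D u w →
    (∀ e → e ∈ displayU D u w → _∈cl_ M e (displayW D u w)) →
    Σ (TreeDec M) (λ D' → (width D' ≤ width D) × (vcount D' < vcount D))
lemma3p1 M record { k = zero ; T-gr = G } zero zero uw _ = ⊥-elim (¬self-edge {G = G} (edge uw))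
lemma3p1 M D₀@record { k = suc K ; T-gr = G ; T-tree = tree ; τ = τ } u w uw U⊆clW
  with leaf-on-side (proj₂ tree) (edge uw)
... | ℓ , p , leaf , u⇝ℓ =
  D′ , width-removeLeaf (side-bag-rd≡0 D₀ (edge uw) U⊆clW u⇝ℓ) , ℕP.n<1+n (suc K)
  where open DeleteLeaf M G tree τ leaf using (D′; width-removeLeaf)
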